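{- Let $p$ be a prime number and let $n=p_1^{\alpha_1}\cdots p_r^{\alpha_r}$, $r\ge 1$, be the prime factorization of an integer $n>1$ (distinct primes $p_i$, exponents $\alpha_i\ge 1$). Then $n$ is $p$-multiplicatively $e$-perfect if and only if for each $i\in\{1,\dots,r\}$ we have $$\sigma(\alpha_i)=\gcd(\alpha_i,\sigma(\alpha_i))\,p\quad\text{and}\quad \alpha_i=\gcd(\alpha_i,\sigma(\alpha_i))\prod_{j\in\{1,\dots,r\}\setminus\{i\}}d(\alpha_j),$$ with $$2^{r-1}\le \prod_{j\in\{1,\dots,r\}\setminus\{i\}}d(\alpha_j)<p,$$ where the empty product is $1$. In particular, if $r=1$, then $\alpha_1\mid\sigma(\alpha_1)$ and $\sigma(\alpha_1)=\alpha_1 p$.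
   Context: $\sigma$ is the sum-of-divisors function and $d$ the number-of-divisors function. For $n=p_1^{a_1}\cdots p_r^{a_r}>1$, a divisor $d$ of $n$ is an exponential divisor ($e$-divisor) if $d=p_1^{b_1}\cdots p_r^{b_r}$ with $b_i\mid a_i$ for all $i$; $T_e(n)$ denotes the product of all $e$-divisors of $n$. For $k\ge 2$, $n$ is $k$-multiplicatively $e$-perfect if $T_e(n)=n^k$. -}

module Defs where

open import Data.Nat using (ℕ; zero; suc; _+_; _*_; _/_; _≤_; _^_)
open import Data.Nat.Divisibility using (_∣_; _∣?_)
open import Data.Nat.Primality using (Prime; prime?)
open import Data.Fin using (Fin; zero; suc)
open import Data.List using (List; upTo; filter; length)
open import Data.Nat.ListAction using (sum; product)
open import Relation.Binary.PropositionalEquality using (_≡_)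
open import Data.List.Relation.Unary.All using (All; all?)
open import Data.Product using (_×_)
open import Relation.Nullary using (Dec; yes; no)
open import Relation.Nullary.Decidable using (_×-dec_; _→-dec_)

-- divisors of n: all d ∈ {0,…,n} with d ∣ n  (0 ∣ n fails for n > 0)
divisors : ℕ → List ℕ
divisors n = filter (λ d → d ∣? n) (upTo (suc n))

-- sum-of-divisors function σ and number-of-divisors function d (named τ)
σ : ℕ → ℕ
σ n = sum (divisors n)

τ : ℕ → ℕ
τ n = length (divisors n)

-- p-adic valuation ν q m (exponent of q in m), for q ≥ 2 and m ≥ 1;
-- computed with fuel m (enough since q ≥ 2). Conventions: ν q 0 = 0, ν 0/1 m = 0.
νfuel : ℕ → ℕ → ℕ → ℕ
νfuel zero q m = 0
νfuel (suc f) zero m = 0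
νfuel (suc f) (suc zero) m = 0
νfuel (suc f) q@(suc (suc _)) m with q ∣? m
... | yes _ = suc (νfuel f q (m / q))
... | no _ = 0

ν : ℕ → ℕ → ℕ
ν q m = νfuel m q m

-- d is an exponential divisor of n (n ≥ 1): d ∣ n and for every prime q ∣ n
-- the exponent of q in d divides the exponent of q in n. (Every prime factor
-- of n is ≤ n, so quantifying over q ∈ {0,…,n} suffices; primes not dividing n
-- have exponent 0 in d.)  This is exactly the paper's definition
-- d = ∏ p_i^{b_i}, b_i ∣ a_i.
IsEDiv : ℕ → ℕ → Set
IsEDiv n d = d ∣ n × All (λ q → Prime q → q ∣ n → ν q d ∣ ν q n) (upTo (suc n))

isEDiv? : (n d : ℕ) → Dec (IsEDiv n d)
isEDiv? n d = (d ∣? n) ×-dec all? (λ q → prime? q →-dec ((q ∣? n) →-dec (ν q d ∣? ν q n))) (upTo (suc n))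

Tₑ : ℕ → ℕ
Tₑ n = product (filter (isEDiv? n) (upTo (suc n)))

∏ : (r : ℕ) → (Fin r → ℕ) → ℕ
∏ zero f = 1
∏ (suc r) f = f zero * ∏ r (λ j → f (suc j))

∏≠ : (r : ℕ) → Fin r → (Fin r → ℕ) → ℕ
∏≠ (suc r) zero f = ∏ r (λ j → f (suc j))
∏≠ (suc r) (suc i) f = f zero * ∏≠ r i (λ j → f (suc j))

MultEPerfect : ℕ → ℕ → Set
MultEPerfect k n = Tₑ n ≡ n ^ k

module Submission where

-- The e-divisors of n = ∏ pᵢ^αᵢ are the numbers ∏ pᵢ^bᵢ with bᵢ ∣ αᵢ, so collecting the
-- exponent of each pᵢ gives Tₑ(n) = ∏ pᵢ^(σ(αᵢ) Pᵢ) with Pᵢ = ∏_{j≠i} d(αⱼ).  By unique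
-- factorisation, Tₑ(n) = n^p is therefore the system σ(αᵢ) Pᵢ = αᵢ p.  No αᵢ can be 1:
-- otherwise Pᵢ = p, hence ∏ⱼ d(αⱼ) = p and σ(αⱼ) = αⱼ d(αⱼ) for every j, which forces every
-- αⱼ = 1 and ∏ⱼ d(αⱼ) = 1.  So αᵢ < σ(αᵢ); after cancelling g = gcd(αᵢ, σ(αᵢ)) the cofactor
-- σ(αᵢ)/g is coprime to αᵢ/g and divides p, and it is not 1, so it is p.  This gives both
-- equations and Pᵢ < p; the lower bound 2^(r-1) ≤ Pᵢ is d(αⱼ) ≥ 2.

open import Defs
open import Data.Empty using (⊥-elim)
open import Data.Fin using (Fin; zero; suc; punchIn)
open import Data.Fin.Properties using (punchInᵢ≢i) renaming (suc-injective to Fin-suc-injective)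
open import Data.List using (List; []; _∷_; _++_; map; filter; upTo; length; cartesianProductWith)
open import Data.List.Properties using (map-++; map-∘; length-++; length-map; filter-++; filter-accept; upTo-∷ʳ)
open import Data.List.Membership.Propositional using (_∈_)
open import Data.List.Membership.Propositional.Properties
  using ( ∈-map⁺; ∈-map⁻; ∈-filter⁺; ∈-filter⁻; ∈-upTo⁺; ∈-upTo⁻
        ; ∈-cartesianProductWith⁺; ∈-cartesianProductWith⁻)
open import Data.List.Membership.Propositional.Properties.WithK using (unique∧set⇒bag)
open import Data.List.Relation.Binary.BagAndSetEquality using (∼bag⇒↭)
import Data.List.Relation.Unary.All as All
open import Data.List.Relation.Unary.Any using (here; there)
open import Data.List.Relation.Unary.Unique.Propositional using (Unique; []; _∷_)
import Data.List.Relation.Unary.Unique.Propositional.Properties as Unique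
open import Data.Nat
open import Data.Nat.Properties
open import Data.Nat.Divisibility
open import Data.Nat.DivMod using (m/n*n≡m; m*n/n≡m)
open import Data.Nat.GCD using (gcd; gcd[m,n]∣m; gcd[m,n]∣n; gcd[m,n]≢0)
open import Data.Nat.Coprimality using (Coprime; coprime-divisor; coprime-/gcd)
import Data.Nat.Coprimality as Coprime
open import Data.Nat.Induction using (<-wellFounded)
open import Data.Nat.ListAction using (sum; product)
open import Data.Nat.ListAction.Properties using (sum-++; product-++; product-↭)
open import Data.Nat.Primality using (Prime; prime⇒nonZero; prime⇒nonTrivial; prime⇒irreducible; euclidsLemma)
open import Data.Product using (∃; ∃₂; _×_; _,_; proj₁; proj₂)
open import Data.Sum using (_⊎_; inj₁; inj₂)
open import Data.Vec using (Vec; []; _∷_; lookup)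
open import Data.Vec.Properties using (∷-injective)
open import Data.Vec.Relation.Binary.Pointwise.Extensional using (ext; Pointwise-≡⇒≡)
open import Function using (_∘_)
open import Function.Bundles using (_⇔_; mk⇔; Equivalence)
open import Induction.WellFounded using (Acc; acc)
open import Relation.Nullary using (¬_; yes; no)
open import Relation.Binary.PropositionalEquality

open import Algebra.Properties.CommutativeSemigroup *-commutativeSemigroup
  using (x∙yz≈y∙xz; xy∙z≈xz∙y; xy∙z≈zx∙y)

-- Products over Fin

∏-cong : ∀ r {f g : Fin r → ℕ} → (∀ i → f i ≡ g i) → ∏ r f ≡ ∏ r g
∏-cong zero    eq = refl
∏-cong (suc r) eq = cong₂ _*_ (eq zero) (∏-cong r (eq ∘ suc))

∏-const-1 : ∀ r → ∏ r (λ _ → 1) ≡ 1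
∏-const-1 zero    = refl
∏-const-1 (suc r) = trans (+-identityʳ _) (∏-const-1 r)

∏-split : ∀ r (i : Fin r) f → ∏ r f ≡ f i * ∏≠ r i f
∏-split (suc r) zero    f = refl
∏-split (suc r) (suc i) f = begin
  f zero * ∏ r (f ∘ suc)                    ≡⟨ cong (f zero *_) (∏-split r i (f ∘ suc)) ⟩
  f zero * (f (suc i) * ∏≠ r i (f ∘ suc))   ≡⟨ x∙yz≈y∙xz (f zero) (f (suc i)) _ ⟩
  f (suc i) * (f zero * ∏≠ r i (f ∘ suc))   ∎
  where open ≡-Reasoning

∏≠-punchIn : ∀ r (i : Fin (suc r)) f → ∏≠ (suc r) i f ≡ ∏ r (f ∘ punchIn i)
∏≠-punchIn r       zero    f = refl
∏≠-punchIn zero    (suc ()) f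
∏≠-punchIn (suc r) (suc i) f = cong (f zero *_) (∏≠-punchIn r i (f ∘ suc))

∏-nonZero : ∀ r (f : Fin r → ℕ) → (∀ j → NonZero (f j)) → NonZero (∏ r f)
∏-nonZero zero    f nz = _
∏-nonZero (suc r) f nz = m*n≢0 (f zero) _ {{nz zero}} {{∏-nonZero r (f ∘ suc) (nz ∘ suc)}}

∏-mono-∣ : ∀ r {f g : Fin r → ℕ} → (∀ j → f j ∣ g j) → ∏ r f ∣ ∏ r g
∏-mono-∣ zero    f∣g = ∣-refl
∏-mono-∣ (suc r) f∣g = *-pres-∣ (f∣g zero) (∏-mono-∣ r (f∣g ∘ suc))

^-distribʳ-* : ∀ m n k → (m * n) ^ k ≡ m ^ k * n ^ k
^-distribʳ-* m n zero    = refl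
^-distribʳ-* m n (suc k) = begin
  m * n * (m * n) ^ k       ≡⟨ cong (m * n *_) (^-distribʳ-* m n k) ⟩
  m * n * (m ^ k * n ^ k)   ≡⟨ [m*n]*[o*p]≡[m*o]*[n*p] m n (m ^ k) (n ^ k) ⟩
  m * m ^ k * (n * n ^ k)   ∎
  where open ≡-Reasoning

∏-^ : ∀ r (f : Fin r → ℕ) k → ∏ r f ^ k ≡ ∏ r (λ i → f i ^ k)
∏-^ zero    f k = ^-zeroˡ k
∏-^ (suc r) f k =
  trans (^-distribʳ-* (f zero) (∏ r (f ∘ suc)) k) (cong (f zero ^ k *_) (∏-^ r (f ∘ suc) k))

2^r≤∏ : ∀ r (f : Fin r → ℕ) → (∀ j → 2 ≤ f j) → 2 ^ r ≤ ∏ r f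
2^r≤∏ zero    f 2≤f = ≤-refl
2^r≤∏ (suc r) f 2≤f = *-mono-≤ (2≤f zero) (2^r≤∏ r (f ∘ suc) (2≤f ∘ suc))

2^[r∸1]≤∏≠ : ∀ r (i : Fin r) f → (∀ j → 2 ≤ f j) → 2 ^ (r ∸ 1) ≤ ∏≠ r i f
2^[r∸1]≤∏≠ (suc r) i f 2≤f =
  subst (2 ^ r ≤_) (sym (∏≠-punchIn r i f)) (2^r≤∏ r (f ∘ punchIn i) (2≤f ∘ punchIn i))

m∣m^n : ∀ m {n} → 1 ≤ n → m ∣ m ^ n
m∣m^n m {suc n} _ = m∣m*n (m ^ n)

^-monoʳ-∣ : ∀ m {b a} → b ≤ a → m ^ b ∣ m ^ a
^-monoʳ-∣ m {b} b≤a =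
  subst (m ^ b ∣_) (trans (sym (^-distribˡ-+-* m b _)) (cong (m ^_) (m+[n∸m]≡n b≤a))) (m∣m*n _)

n<m^n : ∀ {m} → 1 < m → ∀ n → n < m ^ n
n<m^n 1<m zero    = s≤s z≤n
n<m^n {m} 1<m (suc n) =
  ≤-<-trans (n<m^n 1<m n) (subst (m ^ n <_) (*-comm (m ^ n) m) (m<m*n (m ^ n) m 1<m))
  where instance
    _ : NonZero (m ^ n)
    _ = m^n≢0 m n {{>-nonZero (<-trans z<s 1<m)}}

-- Primes and valuations

prime>1 : ∀ {p} → Prime p → 1 < p
prime>1 {p} pp = nonTrivial⇒n>1 p {{prime⇒nonTrivial pp}}

prime∤1 : ∀ {p} → Prime p → ¬ p ∣ 1
prime∤1 pp p∣1 = <⇒≢ (prime>1 pp) (sym (∣1⇒≡1 p∣1))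

prime∣prime⇒≡ : ∀ {q p} → Prime q → Prime p → q ∣ p → q ≡ p
prime∣prime⇒≡ qq pp q∣p with prime⇒irreducible pp q∣p
... | inj₁ q≡1 = ⊥-elim (prime∤1 qq (subst (_∣ 1) (sym q≡1) ∣-refl))
... | inj₂ q≡p = q≡p

prime∣prime^⇒≡ : ∀ {q p} e → Prime q → Prime p → q ∣ p ^ e → q ≡ p
prime∣prime^⇒≡ zero    qq pp q∣1 = ⊥-elim (prime∤1 qq q∣1)
prime∣prime^⇒≡ (suc e) qq pp q∣p^e with euclidsLemma _ _ qq q∣p^e
... | inj₁ q∣p   = prime∣prime⇒≡ qq pp q∣p
... | inj₂ q∣p^e = prime∣prime^⇒≡ e qq pp q∣p^e

prime∣∏⇒∣ : ∀ {q} → Prime q → ∀ r (f : Fin r → ℕ) → q ∣ ∏ r f → ∃ λ j → q ∣ f j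
prime∣∏⇒∣ qq zero    f q∣1 = ⊥-elim (prime∤1 qq q∣1)
prime∣∏⇒∣ qq (suc r) f q∣∏ with euclidsLemma _ _ qq q∣∏
... | inj₁ q∣f₀ = zero , q∣f₀
... | inj₂ q∣∏′ = let j , q∣fj = prime∣∏⇒∣ qq r (f ∘ suc) q∣∏′ in suc j , q∣fj

prime∤∏≠ : ∀ {q} → Prime q → ∀ r (i : Fin r) f → (∀ j → j ≢ i → ¬ q ∣ f j) → ¬ q ∣ ∏≠ r i f
prime∤∏≠ qq (suc r) i f q∤f q∣∏≠ =
  let j , q∣f = prime∣∏⇒∣ qq r (f ∘ punchIn i) (subst (_ ∣_) (∏≠-punchIn r i f) q∣∏≠)
  in q∤f (punchIn i j) (punchInᵢ≢i i j) q∣f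

¬∣⇒coprime : ∀ {p d} → Prime p → ¬ p ∣ d → Coprime d p
¬∣⇒coprime pp p∤d (c∣d , c∣p) with prime⇒irreducible pp c∣p
... | inj₁ c≡1 = c≡1
... | inj₂ refl = ⊥-elim (p∤d c∣d)

∣p^a*m⇒∣m : ∀ {p d} → Prime p → ¬ p ∣ d → ∀ a {m} → d ∣ p ^ a * m → d ∣ m
∣p^a*m⇒∣m pp p∤d zero    {m} d∣ = subst (_ ∣_) (*-identityˡ m) d∣
∣p^a*m⇒∣m {p} {d} pp p∤d (suc a) {m} d∣ =
  ∣p^a*m⇒∣m pp p∤d a (coprime-divisor (¬∣⇒coprime pp p∤d) (subst (d ∣_) (*-assoc p (p ^ a) m) d∣))

p-free-part : ∀ {p} → Prime p → ∀ d → .{{NonZero d}} → ∃₂ λ b m → d ≡ p ^ b * m × ¬ p ∣ m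
p-free-part {p} pp d = go d (<-wellFounded d)
  where
  go : ∀ d → Acc _<_ d → .{{NonZero d}} → ∃₂ λ b m → d ≡ p ^ b * m × ¬ p ∣ m
  go d (acc rec) with p ∣? d
  ... | no p∤d = 0 , d , sym (*-identityˡ d) , p∤d
  ... | yes (divides e refl) =
    let instance _ = m*n≢0⇒m≢0 e
        b , m , e≡p^b*m , p∤m = go e (rec (m<m*n e p (prime>1 pp)))
    in suc b , m , trans (cong (_* p) e≡p^b*m) (xy∙z≈zx∙y (p ^ b) m p) , p∤m

νfuel-q^k*m : ∀ q {m} → ¬ 2+ q ∣ m → ∀ f k → k ≤ f → νfuel f (2+ q) ((2+ q) ^ k * m) ≡ k
νfuel-q^k*m q {m} q∤m zero    zero    _ = refl
νfuel-q^k*m q {m} q∤m (suc f) zero    _ with 2+ q ∣? (1 * m)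
... | yes q∣m = ⊥-elim (q∤m (subst (2+ q ∣_) (*-identityˡ m) q∣m))
... | no  _   = refl
νfuel-q^k*m q {m} q∤m (suc f) (suc k) (s≤s k≤f) with 2+ q ∣? ((2+ q) ^ suc k * m)
... | no  q∤  = ⊥-elim (q∤ (subst (2+ q ∣_) (sym (*-assoc (2+ q) ((2+ q) ^ k) m)) (m∣m*n ((2+ q) ^ k * m))))
... | yes _   = cong suc (trans (cong (νfuel f (2+ q)) Q^[1+k]*m/Q≡Q^k*m) (νfuel-q^k*m q q∤m f k k≤f))
  where
  Q = 2+ q
  Q^[1+k]*m/Q≡Q^k*m : Q ^ suc k * m / Q ≡ Q ^ k * m
  Q^[1+k]*m/Q≡Q^k*m = trans (cong (_/ Q) (trans (*-assoc Q (Q ^ k) m) (*-comm Q (Q ^ k * m))))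
                            (m*n/n≡m (Q ^ k * m) Q)

ν[q^k*m]≡k : ∀ {q m} → 1 < q → ¬ q ∣ m → ∀ k → ν q (q ^ k * m) ≡ k
ν[q^k*m]≡k {_}    {zero}  _                  q∤m k = ⊥-elim (q∤m (_ ∣0))
ν[q^k*m]≡k {2+ q} {suc m} 1<q@(s≤s (s≤s _)) q∤m k =
  νfuel-q^k*m q q∤m _ k (≤-trans (<⇒≤ (n<m^n 1<q k)) (m≤m*n ((2+ q) ^ k) (suc m)))

-- Divisors, σ and τ

∈-divisors⁺ : ∀ {d a} → .{{NonZero a}} → d ∣ a → d ∈ divisors a
∈-divisors⁺ {a = a} d∣a = ∈-filter⁺ (_∣? a) (∈-upTo⁺ (s≤s (∣⇒≤ d∣a))) d∣a

∈-divisors⁻ : ∀ {d a} → d ∈ divisors a → d ∣ a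
∈-divisors⁻ {a = a} = proj₂ ∘ ∈-filter⁻ (_∣? a) {xs = upTo (suc a)}

divisors-unique : ∀ a → Unique (divisors a)
divisors-unique a = Unique.filter⁺ (_∣? a) (Unique.upTo⁺ (suc a))

properDivisors : ℕ → List ℕ
properDivisors a = filter (_∣? a) (upTo a)

divisors≡properDivisors++[n] : ∀ a → divisors a ≡ properDivisors a ++ a ∷ []
divisors≡properDivisors++[n] a = begin
  filter (_∣? a) (upTo (suc a))          ≡⟨ cong (filter (_∣? a)) (upTo-∷ʳ a) ⟨
  filter (_∣? a) (upTo a ++ a ∷ [])      ≡⟨ filter-++ (_∣? a) (upTo a) (a ∷ []) ⟩
  properDivisors a ++ filter (_∣? a) (a ∷ [])  ≡⟨ cong (properDivisors a ++_) (filter-accept (_∣? a) ∣-refl) ⟩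
  properDivisors a ++ a ∷ []             ∎
  where open ≡-Reasoning

σ≡sum[properDivisors]+n : ∀ a → σ a ≡ sum (properDivisors a) + a
σ≡sum[properDivisors]+n a = begin
  σ a                                              ≡⟨ cong sum (divisors≡properDivisors++[n] a) ⟩
  sum (properDivisors a ++ a ∷ [])                 ≡⟨ sum-++ (properDivisors a) (a ∷ []) ⟩
  sum (properDivisors a) + (a + 0)                 ≡⟨ cong (sum (properDivisors a) +_) (+-identityʳ a) ⟩
  sum (properDivisors a) + a                       ∎
  where open ≡-Reasoning

τ≡1+length[properDivisors] : ∀ a → τ a ≡ suc (length (properDivisors a))
τ≡1+length[properDivisors] a =
  trans (cong length (divisors≡properDivisors++[n] a)) (trans (length-++ (properDivisors a)) (+-comm _ 1))

1∈properDivisors : ∀ {a} → 2 ≤ a → 1 ∈ properDivisors a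
1∈properDivisors {a} 2≤a = ∈-filter⁺ (_∣? a) (∈-upTo⁺ 2≤a) (1∣ a)

∈properDivisors⇒< : ∀ {d a} → d ∈ properDivisors a → d < a
∈properDivisors⇒< {a = a} = ∈-upTo⁻ ∘ proj₁ ∘ ∈-filter⁻ (_∣? a) {xs = upTo a}

∈⇒≤sum : ∀ {x xs} → x ∈ xs → x ≤ sum xs
∈⇒≤sum {xs = y ∷ xs} (here refl) = m≤m+n y (sum xs)
∈⇒≤sum {xs = y ∷ xs} (there x∈) = ≤-trans (∈⇒≤sum x∈) (m≤n+m (sum xs) y)

∈⇒length>0 : ∀ {A : Set} {x : A} {xs} → x ∈ xs → 0 < length xs
∈⇒length>0 {xs = _ ∷ _} _ = z<s

sum+length≤*length : ∀ a xs → (∀ {x} → x ∈ xs → x < a) → sum xs + length xs ≤ a * length xs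
sum+length≤*length a []       _    = z≤n
sum+length≤*length a (x ∷ xs) all< = begin
  x + sum xs + suc (length xs)     ≡⟨ +-suc (x + sum xs) (length xs) ⟩
  suc (x + sum xs + length xs)     ≡⟨ cong suc (+-assoc x (sum xs) (length xs)) ⟩
  suc x + (sum xs + length xs)     ≤⟨ +-mono-≤ (all< (here refl)) (sum+length≤*length a xs (all< ∘ there)) ⟩
  a + a * length xs                ≡⟨ *-suc a (length xs) ⟨
  a * suc (length xs)              ∎
  where open ≤-Reasoning

n<σ[n] : ∀ {a} → 2 ≤ a → a < σ a
n<σ[n] {a} 2≤a =
  subst (a <_) (sym (σ≡sum[properDivisors]+n a)) (+-monoˡ-≤ a (∈⇒≤sum (1∈properDivisors 2≤a)))

2≤τ : ∀ {a} → 2 ≤ a → 2 ≤ τ a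
2≤τ {a} 2≤a = subst (2 ≤_) (sym (τ≡1+length[properDivisors] a)) (s≤s (∈⇒length>0 (1∈properDivisors 2≤a)))

σ<n*τ : ∀ {a} → 2 ≤ a → σ a < a * τ a
σ<n*τ {a} 2≤a = begin-strict
  σ a                  ≡⟨ σ≡sum[properDivisors]+n a ⟩
  sum ds + a           <⟨ +-monoˡ-< a sum<a*length ⟩
  a * length ds + a    ≡⟨ +-comm (a * length ds) a ⟩
  a + a * length ds    ≡⟨ *-suc a (length ds) ⟨
  a * suc (length ds)  ≡⟨ cong (a *_) (τ≡1+length[properDivisors] a) ⟨
  a * τ a              ∎
  where
  open ≤-Reasoning
  ds = properDivisors a
  sum<a*length : sum ds < a * length ds
  sum<a*length = <-≤-trans (m<m+n (sum ds) (∈⇒length>0 (1∈properDivisors 2≤a)))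
                           (sum+length≤*length a ds ∈properDivisors⇒<)

σ≡n*τ⇒n≡1 : ∀ {a} → 1 ≤ a → σ a ≡ a * τ a → a ≡ 1
σ≡n*τ⇒n≡1 {a} 1≤a σ≡a*τ with 2 ≤? a
... | yes 2≤a = ⊥-elim (<⇒≢ (σ<n*τ 2≤a) σ≡a*τ)
... | no  2≰a = ≤-antisym (≤-pred (≰⇒> 2≰a)) 1≤a

-- Products of powers of distinct primes

infix 8 _∏^_

_∏^_ : ∀ {r} → (Fin r → ℕ) → (Fin r → ℕ) → ℕ
_∏^_ {r} ps es = ∏ r (λ j → ps j ^ es j)

∏^-^ : ∀ {r} (ps es : Fin r → ℕ) k → (ps ∏^ es) ^ k ≡ ps ∏^ (λ j → es j * k)
∏^-^ {r} ps es k = trans (∏-^ r _ k) (∏-cong r (λ j → ^-*-assoc (ps j) (es j) k))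

record DistinctPrimes {r} (ps : Fin r → ℕ) : Set where
  field
    prime     : ∀ i → Prime (ps i)
    injective : ∀ i j → ps i ≡ ps j → i ≡ j

DistinctPrimes-tail : ∀ {r} {ps : Fin (suc r) → ℕ} → DistinctPrimes ps → DistinctPrimes (ps ∘ suc)
DistinctPrimes-tail dp = record
  { prime     = prime ∘ suc
  ; injective = λ i j → Fin-suc-injective ∘ injective (suc i) (suc j)
  }
  where open DistinctPrimes dp

module _ {r} {ps : Fin r → ℕ} (dp : DistinctPrimes ps) where
  open DistinctPrimes dp

  ∏^-nonZero : ∀ es → NonZero (ps ∏^ es)
  ∏^-nonZero es = ∏-nonZero r _ (λ j → m^n≢0 (ps j) (es j) {{prime⇒nonZero (prime j)}})

  prime∣∏^⇒≡ : ∀ {q} → Prime q → ∀ es → q ∣ ps ∏^ es → ∃ λ j → q ≡ ps j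
  prime∣∏^⇒≡ qq es q∣∏ =
    let j , q∣ps^e = prime∣∏⇒∣ qq r (λ j → ps j ^ es j) q∣∏
    in j , prime∣prime^⇒≡ (es j) qq (prime j) q∣ps^e

  ∣∏^ : ∀ es i → 1 ≤ es i → ps i ∣ ps ∏^ es
  ∣∏^ es i 1≤e =
    subst (ps i ∣_) (sym (∏-split r i (λ j → ps j ^ es j))) (∣m⇒∣m*n _ (m∣m^n (ps i) 1≤e))

  ∤∏^≠ : ∀ (es : Fin r → ℕ) i → ¬ ps i ∣ ∏≠ r i (λ j → ps j ^ es j)
  ∤∏^≠ es i = prime∤∏≠ (prime i) r i (λ j → ps j ^ es j) λ j j≢i ps[i]∣ →
    j≢i (injective j i (sym (prime∣prime^⇒≡ (es j) (prime i) (prime j) ps[i]∣)))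

  ν-∏^ : ∀ es i → ν (ps i) (ps ∏^ es) ≡ es i
  ν-∏^ es i = trans (cong (ν (ps i)) (∏-split r i (λ j → ps j ^ es j)))
                    (ν[q^k*m]≡k (prime>1 (prime i)) (∤∏^≠ es i) (es i))

  ∏^-injective : ∀ {es fs} → ps ∏^ es ≡ ps ∏^ fs → ∀ i → es i ≡ fs i
  ∏^-injective {es} {fs} eq i = trans (sym (ν-∏^ es i)) (trans (cong (ν (ps i)) eq) (ν-∏^ fs i))

∣∏^⇒≡∏^ : ∀ {r} {ps : Fin r → ℕ} → DistinctPrimes ps → ∀ αs {d} → d ∣ ps ∏^ αs →
          ∃ λ (bs : Vec ℕ r) → d ≡ ps ∏^ lookup bs
∣∏^⇒≡∏^ {zero}          dp αs d∣1 = [] , ∣1⇒≡1 d∣1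
∣∏^⇒≡∏^ {suc r} {ps} dp αs {d} d∣ =
  let b , m , d≡p^b*m , p∤m = p-free-part p[0] d
      m∣d = subst (m ∣_) (sym d≡p^b*m) (n∣m*n (ps zero ^ b))
      m∣ = ∣p^a*m⇒∣m p[0] p∤m (αs zero) (∣-trans m∣d d∣)
      bs , m≡ = ∣∏^⇒≡∏^ (DistinctPrimes-tail dp) (αs ∘ suc) m∣
  in b ∷ bs , trans d≡p^b*m (cong (ps zero ^ b *_) m≡)
  where
  p[0] = DistinctPrimes.prime dp zero
  instance
    _ : NonZero d
    _ = ≢-nonZero λ { refl → ≢-nonZero⁻¹ _ {{∏^-nonZero dp αs}} (0∣⇒≡0 d∣) }

-- Exponential divisors of a product of prime powers

module _ {A B C : Set} (f : A → B → C) where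

  length-cartesianProductWith : ∀ xs ys → length (cartesianProductWith f xs ys) ≡ length xs * length ys
  length-cartesianProductWith []       ys = refl
  length-cartesianProductWith (x ∷ xs) ys =
    trans (length-++ (map (f x) ys)) (cong₂ _+_ (length-map (f x) ys) (length-cartesianProductWith xs ys))

  map-cartesianProductWith : ∀ {D : Set} (g : C → D) xs ys →
    map g (cartesianProductWith f xs ys) ≡ cartesianProductWith (λ x y → g (f x y)) xs ys
  map-cartesianProductWith g []       ys = refl
  map-cartesianProductWith g (x ∷ xs) ys = begin
    map g (map (f x) ys ++ cartesianProductWith f xs ys)
      ≡⟨ map-++ g (map (f x) ys) _ ⟩
    map g (map (f x) ys) ++ map g (cartesianProductWith f xs ys)
      ≡⟨ cong₂ _++_ (sym (map-∘ ys)) (map-cartesianProductWith g xs ys) ⟩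
    map (g ∘ f x) ys ++ cartesianProductWith (λ x y → g (f x y)) xs ys ∎
    where open ≡-Reasoning

product-map-*ˡ : ∀ {B : Set} k (g : B → ℕ) xs →
                 product (map (λ x → k * g x) xs) ≡ k ^ length xs * product (map g xs)
product-map-*ˡ k g []       = refl
product-map-*ˡ k g (x ∷ xs) = trans (cong (k * g x *_) (product-map-*ˡ k g xs))
                                    ([m*n]*[o*p]≡[m*o]*[n*p] k (g x) (k ^ length xs) (product (map g xs)))

product-cartesianProductWith-^* : ∀ {B : Set} c (g : B → ℕ) bs xs →
  product (cartesianProductWith (λ b x → c ^ b * g x) bs xs) ≡ c ^ (sum bs * length xs) * product (map g xs) ^ length bs
product-cartesianProductWith-^* c g []       xs = sym (*-identityʳ 1)
product-cartesianProductWith-^* c g (b ∷ bs) xs = begin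
  product (map (λ x → c ^ b * g x) xs ++ rest)
    ≡⟨ product-++ (map (λ x → c ^ b * g x) xs) rest ⟩
  product (map (λ x → c ^ b * g x) xs) * product rest
    ≡⟨ cong₂ _*_ (product-map-*ˡ (c ^ b) g xs) (product-cartesianProductWith-^* c g bs xs) ⟩
  (c ^ b) ^ L * G * (c ^ (sum bs * L) * G ^ length bs)
    ≡⟨ [m*n]*[o*p]≡[m*o]*[n*p] ((c ^ b) ^ L) G (c ^ (sum bs * L)) (G ^ length bs) ⟩
  (c ^ b) ^ L * c ^ (sum bs * L) * (G * G ^ length bs)
    ≡⟨ cong (λ x → x * c ^ (sum bs * L) * (G * G ^ length bs)) (^-*-assoc c b L) ⟩
  c ^ (b * L) * c ^ (sum bs * L) * (G * G ^ length bs)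
    ≡⟨ cong (_* (G * G ^ length bs)) (^-distribˡ-+-* c (b * L) (sum bs * L)) ⟨
  c ^ (b * L + sum bs * L) * (G * G ^ length bs)
    ≡⟨ cong (λ e → c ^ e * (G * G ^ length bs)) (*-distribʳ-+ L b (sum bs)) ⟨
  c ^ ((b + sum bs) * L) * (G * G ^ length bs) ∎
  where
  open ≡-Reasoning
  rest = cartesianProductWith (λ b x → c ^ b * g x) bs xs
  L = length xs
  G = product (map g xs)

-- Enumerating exponent vectors rather than e-divisors makes uniqueness of the list a matter
-- of injectivity of _∷_ and of bs ↦ ∏ⱼ pⱼ^bⱼ.
exponentVectors : ∀ {r} → (Fin r → ℕ) → List (Vec ℕ r)
exponentVectors {zero}  αs = [] ∷ []
exponentVectors {suc r} αs = cartesianProductWith _∷_ (divisors (αs zero)) (exponentVectors (αs ∘ suc))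

∈-exponentVectors⁺ : ∀ {r} (αs : Fin r → ℕ) bs →
                     (∀ j → lookup bs j ∈ divisors (αs j)) → bs ∈ exponentVectors αs
∈-exponentVectors⁺ {zero}  αs []       _  = here refl
∈-exponentVectors⁺ {suc r} αs (b ∷ bs) b∈ =
  ∈-cartesianProductWith⁺ _∷_ (b∈ zero) (∈-exponentVectors⁺ (αs ∘ suc) bs (b∈ ∘ suc))

∈-exponentVectors⁻ : ∀ {r} (αs : Fin r → ℕ) {bs} →
                     bs ∈ exponentVectors αs → ∀ j → lookup bs j ∈ divisors (αs j)
∈-exponentVectors⁻ {suc r} αs bs∈ j
  with _ , _ , b∈ , tail∈ , refl
         ← ∈-cartesianProductWith⁻ _∷_ (divisors (αs zero)) (exponentVectors (αs ∘ suc)) bs∈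
  with j
... | zero  = b∈
... | suc j = ∈-exponentVectors⁻ (αs ∘ suc) tail∈ j

exponentVectors-unique : ∀ {r} (αs : Fin r → ℕ) → Unique (exponentVectors αs)
exponentVectors-unique {zero}  αs = All.[] ∷ []
exponentVectors-unique {suc r} αs =
  Unique.cartesianProductWith⁺ _∷_ ∷-injective (divisors-unique (αs zero)) (exponentVectors-unique (αs ∘ suc))

length-exponentVectors : ∀ {r} (αs : Fin r → ℕ) → length (exponentVectors αs) ≡ ∏ r (τ ∘ αs)
length-exponentVectors {zero}  αs = refl
length-exponentVectors {suc r} αs =
  trans (length-cartesianProductWith _∷_ (divisors (αs zero)) _)
        (cong (τ (αs zero) *_) (length-exponentVectors (αs ∘ suc)))

eDivisorsOf : ∀ {r} → (Fin r → ℕ) → (Fin r → ℕ) → List ℕ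
eDivisorsOf ps αs = map (λ bs → ps ∏^ lookup bs) (exponentVectors αs)

product-eDivisorsOf : ∀ {r} (ps αs : Fin r → ℕ) →
  product (eDivisorsOf ps αs) ≡ ps ∏^ (λ i → σ (αs i) * ∏≠ r i (τ ∘ αs))
product-eDivisorsOf {zero}  ps αs = refl
product-eDivisorsOf {suc r} ps αs = begin
  product (map (λ bs → ps ∏^ lookup bs) (cartesianProductWith _∷_ (divisors α₀) vs))
    ≡⟨ cong product (map-cartesianProductWith _∷_ (λ bs → ps ∏^ lookup bs) (divisors α₀) vs) ⟩
  product (cartesianProductWith (λ b bs → p ^ b * ps′ ∏^ lookup bs) (divisors α₀) vs)
    ≡⟨ product-cartesianProductWith-^* p (λ bs → ps′ ∏^ lookup bs) (divisors α₀) vs ⟩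
  p ^ (σ α₀ * length vs) * product (eDivisorsOf ps′ αs′) ^ τ α₀
    ≡⟨ cong₂ (λ l x → p ^ (σ α₀ * l) * x ^ τ α₀) (length-exponentVectors αs′)
                                                  (product-eDivisorsOf ps′ αs′) ⟩
  p ^ (σ α₀ * ∏ r (τ ∘ αs′)) * (ps′ ∏^ E′) ^ τ α₀
    ≡⟨ cong (p ^ (σ α₀ * ∏ r (τ ∘ αs′)) *_)
            (trans (∏^-^ ps′ E′ (τ α₀)) (∏-cong r λ i → cong (ps′ i ^_) (exponent i))) ⟩
  ps ∏^ (λ i → σ (αs i) * ∏≠ (suc r) i (τ ∘ αs)) ∎
  where
  open ≡-Reasoning
  p = ps zero
  ps′ = ps ∘ suc
  α₀ = αs zero
  αs′ = αs ∘ suc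
  vs = exponentVectors αs′
  E′ : Fin r → ℕ
  E′ i = σ (αs′ i) * ∏≠ r i (τ ∘ αs′)
  exponent : ∀ i → E′ i * τ α₀ ≡ σ (αs′ i) * (τ α₀ * ∏≠ r i (τ ∘ αs′))
  exponent i = trans (*-assoc (σ (αs′ i)) _ _) (cong (σ (αs′ i) *_) (*-comm (∏≠ r i (τ ∘ αs′)) (τ α₀)))

module _ {r} {ps : Fin r → ℕ} (dp : DistinctPrimes ps) {αs : Fin r → ℕ} (α≥1 : ∀ j → 1 ≤ αs j) where
  open DistinctPrimes dp

  private
    n = ps ∏^ αs
    instance
      _ : NonZero n
      _ = ∏^-nonZero dp αs
    α≢0 : ∀ j → NonZero (αs j)
    α≢0 j = >-nonZero (α≥1 j)

  isEDiv⇒∈eDivisorsOf : ∀ {d} → IsEDiv n d → d ∈ eDivisorsOf ps αs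
  isEDiv⇒∈eDivisorsOf (d∣n , ν∣ν) with bs , refl ← ∣∏^⇒≡∏^ dp αs d∣n =
    ∈-map⁺ (λ bs → ps ∏^ lookup bs) (∈-exponentVectors⁺ αs bs λ j → ∈-divisors⁺ {{α≢0 j}} (b∣α j))
    where
    ps∣n : ∀ j → ps j ∣ n
    ps∣n j = ∣∏^ dp αs j (α≥1 j)
    b∣α : ∀ j → lookup bs j ∣ αs j
    b∣α j = subst₂ _∣_ (ν-∏^ dp (lookup bs) j) (ν-∏^ dp αs j)
                   (All.lookup ν∣ν (∈-upTo⁺ (s≤s (∣⇒≤ (ps∣n j)))) (prime j) (ps∣n j))

  ∈eDivisorsOf⇒isEDiv : ∀ {d} → d ∈ eDivisorsOf ps αs → IsEDiv n d
  ∈eDivisorsOf⇒isEDiv d∈ with bs , bs∈ , refl ← ∈-map⁻ (λ bs → ps ∏^ lookup bs) d∈ =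
    ∏-mono-∣ r (λ j → ^-monoʳ-∣ (ps j) (∣⇒≤ {{α≢0 j}} (b∣α j))) ,
    All.tabulate ν∣ν
    where
    b∣α : ∀ j → lookup bs j ∣ αs j
    b∣α j = ∈-divisors⁻ (∈-exponentVectors⁻ αs bs∈ j)
    ν∣ν : ∀ {q} → q ∈ upTo (suc n) → Prime q → q ∣ n → ν q (ps ∏^ lookup bs) ∣ ν q n
    ν∣ν _ qq q∣n with j , refl ← prime∣∏^⇒≡ dp qq αs q∣n =
      subst₂ _∣_ (sym (ν-∏^ dp (lookup bs) j)) (sym (ν-∏^ dp αs j)) (b∣α j)

  Tₑ-∏^ : Tₑ n ≡ ps ∏^ (λ i → σ (αs i) * ∏≠ r i (τ ∘ αs))
  Tₑ-∏^ = trans (product-↭ (∼bag⇒↭ (unique∧set⇒bag eDivisors-unique eDivisorsOf-unique (mk⇔ to from))))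
                (product-eDivisorsOf ps αs)
    where
    eDivisors-unique : Unique (filter (isEDiv? n) (upTo (suc n)))
    eDivisors-unique = Unique.filter⁺ (isEDiv? n) (Unique.upTo⁺ (suc n))
    eDivisorsOf-unique : Unique (eDivisorsOf ps αs)
    eDivisorsOf-unique =
      Unique.map⁺ (λ eq → Pointwise-≡⇒≡ (ext (∏^-injective dp eq))) (exponentVectors-unique αs)
    to : ∀ {d} → d ∈ filter (isEDiv? n) (upTo (suc n)) → d ∈ eDivisorsOf ps αs
    to = isEDiv⇒∈eDivisorsOf ∘ proj₂ ∘ ∈-filter⁻ (isEDiv? n) {xs = upTo (suc n)}
    from : ∀ {d} → d ∈ eDivisorsOf ps αs → d ∈ filter (isEDiv? n) (upTo (suc n))
    from d∈ = let isEDiv = ∈eDivisorsOf⇒isEDiv d∈ in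
      ∈-filter⁺ (isEDiv? n) (∈-upTo⁺ (s≤s (∣⇒≤ (proj₁ isEDiv)))) isEDiv

-- The exponent equations

coprime-cofactor : ∀ {p a s P} → Prime p → Coprime a s → s * P ≡ a * p → s ≡ 1 ⊎ (s ≡ p × P ≡ a)
coprime-cofactor {p} {a} {s} {P} pp a⊥s s*P≡a*p with prime⇒irreducible pp s∣p
  where
  s∣p : s ∣ p
  s∣p = coprime-divisor (Coprime.sym a⊥s) (divides P (trans (sym s*P≡a*p) (*-comm s P)))
... | inj₁ s≡1 = inj₁ s≡1
... | inj₂ refl = inj₂ (refl , *-cancelʳ-≡ P a s {{prime⇒nonZero pp}} (trans (*-comm P s) s*P≡a*p))

gcd-conditions : ∀ {p a s P} → Prime p → 2 ≤ a → a < s → s * P ≡ a * p →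
                 s ≡ gcd a s * p × a ≡ gcd a s * P × P < p
gcd-conditions {p} {a} {s} {P} pp 2≤a a<s s*P≡a*p = conclude (coprime-cofactor pp (coprime-/gcd a s) s′*P≡a′*p)
  where
  g = gcd a s
  instance
    _ : NonZero a
    _ = >-nonZero (<-≤-trans z<s 2≤a)
    _ : NonZero g
    _ = ≢-nonZero (gcd[m,n]≢0 a s (inj₁ (≢-nonZero⁻¹ a)))
  a′ = a / g
  s′ = s / g
  a′*g≡a : a′ * g ≡ a
  a′*g≡a = m/n*n≡m (gcd[m,n]∣m a s)
  s′*g≡s : s′ * g ≡ s
  s′*g≡s = m/n*n≡m (gcd[m,n]∣n a s)
  s′*P≡a′*p : s′ * P ≡ a′ * p
  s′*P≡a′*p = *-cancelʳ-≡ (s′ * P) (a′ * p) g (begin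
    s′ * P * g   ≡⟨ xy∙z≈xz∙y s′ P g ⟩
    s′ * g * P   ≡⟨ cong (_* P) s′*g≡s ⟩
    s * P        ≡⟨ s*P≡a*p ⟩
    a * p        ≡⟨ cong (_* p) a′*g≡a ⟨
    a′ * g * p   ≡⟨ xy∙z≈xz∙y a′ g p ⟩
    a′ * p * g   ∎)
    where open ≡-Reasoning
  conclude : s′ ≡ 1 ⊎ (s′ ≡ p × P ≡ a′) → s ≡ g * p × a ≡ g * P × P < p
  conclude (inj₁ s′≡1) = ⊥-elim (<⇒≱ a<s (subst (_≤ a) s≡g (∣⇒≤ (gcd[m,n]∣m a s))))
    where
    s≡g : g ≡ s
    s≡g = trans (sym (*-identityˡ g)) (trans (cong (_* g) (sym s′≡1)) s′*g≡s)
  conclude (inj₂ (s′≡p , P≡a′)) = s≡g*p , a≡g*P , *-cancelˡ-< g P p (subst₂ _<_ a≡g*P s≡g*p a<s)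
    where
    s≡g*p : s ≡ g * p
    s≡g*p = trans (sym s′*g≡s) (trans (cong (_* g) s′≡p) (*-comm p g))
    a≡g*P : a ≡ g * P
    a≡g*P = trans (sym a′*g≡a) (trans (*-comm a′ g) (cong (g *_) (sym P≡a′)))

PerfectionConditions : ℕ → (r : ℕ) → (Fin r → ℕ) → Set
PerfectionConditions p r αs = ∀ i →
  σ (αs i) ≡ gcd (αs i) (σ (αs i)) * p × αs i ≡ gcd (αs i) (σ (αs i)) * ∏≠ r i (τ ∘ αs) ×
  2 ^ (r ∸ 1) ≤ ∏≠ r i (τ ∘ αs) × ∏≠ r i (τ ∘ αs) < p

ExponentEquations : ℕ → (r : ℕ) → (Fin r → ℕ) → Set
ExponentEquations k r αs = ∀ i → σ (αs i) * ∏≠ r i (τ ∘ αs) ≡ αs i * k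

multEPerfect⇔exponentEquations : ∀ {k r} {ps αs : Fin r → ℕ} → DistinctPrimes ps → (∀ j → 1 ≤ αs j) →
                                 MultEPerfect k (ps ∏^ αs) ⇔ ExponentEquations k r αs
multEPerfect⇔exponentEquations {k} {r} {ps} {αs} dp α≥1 = mk⇔
  (λ Tₑ≡n^k → ∏^-injective dp (trans (sym (Tₑ-∏^ dp α≥1)) (trans Tₑ≡n^k (∏^-^ ps αs k))))
  (λ eqs → trans (Tₑ-∏^ dp α≥1) (trans (∏-cong r λ i → cong (ps i ^_) (eqs i)) (sym (∏^-^ ps αs k))))

module _ {p r} {αs : Fin r → ℕ} (pp : Prime p) (α≥1 : ∀ j → 1 ≤ αs j) (eqs : ExponentEquations p r αs) where

  private
    T = ∏ r (τ ∘ αs)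

    σ*T≡n*τ*p : ∀ j → σ (αs j) * T ≡ αs j * τ (αs j) * p
    σ*T≡n*τ*p j = begin
      σ (αs j) * T                              ≡⟨ cong (σ (αs j) *_) (∏-split r j (τ ∘ αs)) ⟩
      σ (αs j) * (τ (αs j) * ∏≠ r j (τ ∘ αs))   ≡⟨ x∙yz≈y∙xz (σ (αs j)) (τ (αs j)) _ ⟩
      τ (αs j) * (σ (αs j) * ∏≠ r j (τ ∘ αs))   ≡⟨ cong (τ (αs j) *_) (eqs j) ⟩
      τ (αs j) * (αs j * p)                     ≡⟨ *-assoc (τ (αs j)) (αs j) p ⟨
      τ (αs j) * αs j * p                       ≡⟨ cong (_* p) (*-comm (τ (αs j)) (αs j)) ⟩
      αs j * τ (αs j) * p                       ∎
      where open ≡-Reasoning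

  exponents≥2 : ∀ i → 2 ≤ αs i
  exponents≥2 i with 2 ≤? αs i
  ... | yes 2≤αᵢ = 2≤αᵢ
  ... | no  2≰αᵢ = ⊥-elim (<⇒≢ (prime>1 pp) (trans (sym T≡1) T≡p))
    where
    instance _ = prime⇒nonZero pp
    αᵢ≡1 : αs i ≡ 1
    αᵢ≡1 = ≤-antisym (≤-pred (≰⇒> 2≰αᵢ)) (α≥1 i)
    -- σ 1 evaluates to 1, so eqs i reads 1 * Pᵢ ≡ 1 * p.
    Pᵢ≡p : ∏≠ r i (τ ∘ αs) ≡ p
    Pᵢ≡p = trans (sym (*-identityˡ _))
                 (trans (subst (λ a → σ a * ∏≠ r i (τ ∘ αs) ≡ a * p) αᵢ≡1 (eqs i)) (*-identityˡ p))
    T≡p : T ≡ p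
    T≡p = begin
      T                             ≡⟨ ∏-split r i (τ ∘ αs) ⟩
      τ (αs i) * ∏≠ r i (τ ∘ αs)    ≡⟨ cong (λ a → τ a * ∏≠ r i (τ ∘ αs)) αᵢ≡1 ⟩
      1 * ∏≠ r i (τ ∘ αs)           ≡⟨ *-identityˡ _ ⟩
      ∏≠ r i (τ ∘ αs)               ≡⟨ Pᵢ≡p ⟩
      p                             ∎
      where open ≡-Reasoning
    all≡1 : ∀ j → αs j ≡ 1
    all≡1 j = σ≡n*τ⇒n≡1 (α≥1 j) (*-cancelʳ-≡ _ _ p (trans (cong (σ (αs j) *_) (sym T≡p)) (σ*T≡n*τ*p j)))
    T≡1 : T ≡ 1
    T≡1 = trans (∏-cong r (λ j → cong τ (all≡1 j))) (∏-const-1 r)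

  exponentEquations⇒perfectionConditions : PerfectionConditions p r αs
  exponentEquations⇒perfectionConditions i =
    let σ≡g*p , α≡g*P , P<p = gcd-conditions pp (exponents≥2 i) (n<σ[n] (exponents≥2 i)) (eqs i)
    in σ≡g*p , α≡g*P , 2^[r∸1]≤∏≠ r i (τ ∘ αs) (2≤τ ∘ exponents≥2) , P<p

perfectionConditions⇒exponentEquations : ∀ {p r} {αs : Fin r → ℕ} →
                                         PerfectionConditions p r αs → ExponentEquations p r αs
perfectionConditions⇒exponentEquations {p} {r} {αs} conds i =
  let σ≡g*p , α≡g*P , _ = conds i
      g = gcd (αs i) (σ (αs i))
      P = ∏≠ r i (τ ∘ αs)
  in trans (cong (_* P) σ≡g*p) (trans (xy∙z≈xz∙y g p P) (cong (_* p) (sym α≡g*P)))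

perfectionConditions-single : ∀ {p} {αs : Fin 1 → ℕ} → PerfectionConditions p 1 αs →
                              ∀ i → αs i ∣ σ (αs i) × σ (αs i) ≡ αs i * p
perfectionConditions-single {p} {αs} conds zero =
  subst (_∣ σ α) g≡α (gcd[m,n]∣n α (σ α)) , trans σ≡g*p (cong (_* p) g≡α)
  where
  α = αs zero
  σ≡g*p : σ α ≡ gcd α (σ α) * p
  σ≡g*p = proj₁ (conds zero)
  g≡α : gcd α (σ α) ≡ α
  g≡α = sym (trans (proj₁ (proj₂ (conds zero))) (*-identityʳ _))

theorem2p9 : (p : ℕ) → Prime p →
  (n r : ℕ) → 1 ≤ r → 1 < n →
  (ps αs : Fin r → ℕ) →
  (∀ i → Prime (ps i)) →
  (∀ i j → ps i ≡ ps j → i ≡ j) →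
  (∀ i → 1 ≤ αs i) →
  n ≡ ∏ r (λ i → ps i ^ αs i) →
  (MultEPerfect p n ⇔
    (∀ i → σ (αs i) ≡ gcd (αs i) (σ (αs i)) * p
         × αs i ≡ gcd (αs i) (σ (αs i)) * ∏≠ r i (λ j → τ (αs j))
         × 2 ^ (r ∸ 1) ≤ ∏≠ r i (λ j → τ (αs j))
         × ∏≠ r i (λ j → τ (αs j)) < p))
  × (r ≡ 1 → MultEPerfect p n → ∀ i → αs i ∣ σ (αs i) × σ (αs i) ≡ αs i * p)
theorem2p9 p pp n r _ _ ps αs ps-prime ps-injective α≥1 refl =
  perfect⇔conditions , λ { refl → perfectionConditions-single ∘ Equivalence.to perfect⇔conditions }
  where
  distinct : DistinctPrimes ps
  distinct = record { prime = ps-prime ; injective = ps-injective }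
  perfect⇔exponentEquations : MultEPerfect p n ⇔ ExponentEquations p r αs
  perfect⇔exponentEquations = multEPerfect⇔exponentEquations distinct α≥1
  perfect⇔conditions : MultEPerfect p n ⇔ PerfectionConditions p r αs
  perfect⇔conditions = mk⇔
    (exponentEquations⇒perfectionConditions pp α≥1 ∘ Equivalence.to perfect⇔exponentEquations)
    (Equivalence.from perfect⇔exponentEquations ∘ perfectionConditions⇒exponentEquations)
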